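{- Let $\mathcal P$ be a crossing-free autarkic collection, and let $\mathcal I/\mathcal P$ be the instance obtained from the original instance $\mathcal I$ by contracting, for each $P\in\mathcal P$, the connector of $P$ (identifying all its vertices into one vertex). Then there exists a feasible solution for $\mathcal I/\mathcal P$ of cost at most $$c(\mathrm{OPT}(\mathcal I))-\mathrm{coverage}(\mathcal P)+\sum_{S\subseteq V:\ |\mathrm{OPT}\cap\delta(S)|\ge2}y_S.$$
   Context: Steiner Forest instance $\mathcal I$: an undirected graph $G=(V,E)$ with nonnegative edge costs $c_e$ and a set $\mathcal D$ of demand pairs $\{a,b\}\subseteq V$; vertices of a demand pair are partners. A solution is $F\subseteq E$ such that each demand pair lies in one connected component of $(V,F)$; $c(F)=\sum_{e\in F}c_e$. $\mathrm{OPT}=\mathrm{OPT}(\mathcal I)$ is a fixed optimal solution that is inclusion-wise minimal. For $U\subseteq V$, $\delta(U)$ is the set of edges with exactly one endpoint in $U$, and $\mathrm{sep}(U)$ the set of demand pairs $\{a,b\}$ with $|\{a,b\}\cap U|=1$. $\varepsilon$-extended moat-growing algorithm (fixed $\varepsilon\ge0$): time $t$ increases from $0$; it maintains $y_S(t)\ge0$ for all $S\subseteq V$, initially $0$; an edge $e$ is tight if $\sum_{S:e\in\delta(S)}y_S(t)=c_e$; $F$ is the set of tight edges and $\mathcal C^t$ the vertex sets of components of $(V,F)$. Each component has a budget (each vertex initially $0$). A component is demand-active if it contains a vertex not yet connected in $(V,F)$ to one of its partners, budget-active if not demand-active but with positive budget, active if either; $\mathcal A^t$ is the set of active components. Each $y_S$,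 $S\in\mathcal A^t$, grows at unit rate; budgets of demand-active components grow at rate $\varepsilon$, those of budget-active components decrease at unit rate; newly tight edges join $F$ and merged components' budgets are summed. $y_S=y_S(\infty)$. Autarkic pair: $P=\{A,B\}$ with $A,B\in\mathrm{supp}(y)$ disjoint, both in $\mathcal A^t$ for some $t$, $\mathrm{sep}(A)=\mathrm{sep}(B)\ne\emptyset$; $\mathrm{sep}(P)=\mathrm{sep}(A)$. Autarkic triple: $P=\{A_1,A_2,A_3\}$ pairwise disjoint, all in $\mathcal A^t$ for some $t$, each $\mathrm{sep}(A_i)\ne\emptyset$, $\mathrm{sep}(A_1\cup A_2\cup A_3)=\emptyset$; $\mathrm{sep}(P)=\bigcup_i\mathrm{sep}(A_i)$. An autarkic collection is a set of autarkic pairs/triples; it is crossing-free if distinct members have disjoint $\mathrm{sep}$. $U\in\mathrm{supp}(y)$ is covered by $\mathcal P$ if some set $A$ of some $P\in\mathcal P$ has $\mathrm{sep}(A)=\mathrm{sep}(U)$; $\mathrm{coverage}(\mathcal P)=\sum_{U\text{ covered}}y_U$. Connectors: for an autarkic pair, a chosen (designated) demand pair $\{a,b\}\in\mathrm{sep}(P)$, and the connector joins $a$ and $b$ directly; for a triple $\{A_1,A_2,A_3\}$, for each $i\ne j$ with $\mathrm{sep}(A_i)\cap\mathrm{sep}(A_j)\ne\emptyset$ a chosen (designated) demand pair in this intersection, and the connector is a minimum-cost Steiner tree in $G$ on all vertices of the designated pairs.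
   Formalization: The edge costs $c_e$ and the parameter $\varepsilon$ of the moat-growing algorithm are nonnegative rationals. -}

module Defs where

open import Function using (_∘_)
open import Data.Nat using (ℕ; zero; suc; _≤ᵇ_)
import Data.Nat as ℕ
open import Data.Fin using (Fin)
open import Data.Fin.Subset using (Subset)
open import Data.Vec using (lookup)
open import Data.Vec.Properties using (≡-dec)
open import Data.Bool using (Bool; true; false; if_then_else_; _xor_; _∧_; _∨_; not)
import Data.Bool as B
open import Data.Maybe using (Maybe; just; nothing)
open import Data.List using (List; []; _∷_; _++_; map)
open import Data.List.Membership.Propositional using (_∈_)
open import Data.List.Relation.Unary.Unique.Propositional using (Unique)
open import Data.Product using (Σ; ∃; _×_; _,_; proj₁; proj₂)
open import Data.Sum using (_⊎_)
open import Relation.Nullary using (¬_; does)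
open import Relation.Binary.PropositionalEquality using (_≡_; _≢_)
open import Data.Rational using (ℚ; 0ℚ; 1ℚ; _+_; _*_; _-_; -_; _≤_; _<_)

ΣF : ∀ {k} → (Fin k → ℚ) → ℚ
ΣF {zero}  f = 0ℚ
ΣF {suc k} f = f Data.Fin.zero + ΣF (f ∘ Data.Fin.suc)

countF : ∀ {k} → (Fin k → Bool) → ℕ
countF {zero}  f = 0
countF {suc k} f = (if f Data.Fin.zero then 1 else 0) ℕ.+ countF (f ∘ Data.Fin.suc)

anyF : ∀ {k} → (Fin k → Bool) → Bool
anyF {zero}  f = false
anyF {suc k} f = f Data.Fin.zero ∨ anyF (f ∘ Data.Fin.suc)

ΣL : ∀ {A : Set} → List A → (A → ℚ) → ℚ
ΣL []       f = 0ℚ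
ΣL (x ∷ xs) f = f x + ΣL xs f

allL : ∀ {A : Set} → List A → (A → Bool) → Bool
allL []       f = true
allL (x ∷ xs) f = f x ∧ allL xs f

anyL : ∀ {A : Set} → List A → (A → Bool) → Bool
anyL []       f = false
anyL (x ∷ xs) f = f x ∨ anyL xs f

eqB : Bool → Bool → Bool
eqB x y = not (x xor y)

sameSet : ∀ {n} → Subset n → Subset n → Bool
sameSet A S = does (≡-dec B._≟_ A S)

subB : ∀ {n} → Subset n → Subset n → Bool
subB {n} S C = not (anyF (λ v → lookup S v ∧ not (lookup C v)))

data Conn {V : Set} (L : V → V → Set) : V → V → Set where
  here  : ∀ {u} → Conn L u u
  step→ : ∀ {u v w} → L u v → Conn L v w → Conn L u w
  step← : ∀ {u v w} → L v u → Conn L v w → Conn L u w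

-- Steiner Forest instance: vertices Fin n, edges Fin m with endpoints
-- `ends`, nonnegative (rational) costs, list of demand pairs.

record Instance : Set where
  field
    n    : ℕ
    m    : ℕ
    ends : Fin m → Fin n × Fin n
    cost : Fin m → ℚ
    cost≥0 : ∀ e → 0ℚ ≤ cost e
    D    : List (Fin n × Fin n)

module _ (I : Instance) where
  open Instance I

  EdgeLink : (Fin m → Set) → Fin n → Fin n → Set
  EdgeLink F u v = ∃ λ e → F e × ends e ≡ (u , v)

  In : ∀ {k} → Subset k → Fin k → Set
  In S x = lookup S x ≡ true

  crossB : Subset n → Fin m → Bool
  crossB S e = lookup S (proj₁ (ends e)) xor lookup S (proj₂ (ends e))

  sepB : Subset n → Fin n × Fin n → Bool
  sepB S d = lookup S (proj₁ d) xor lookup S (proj₂ d)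

  costOf : Subset m → ℚ
  costOf F = ΣF (λ e → if lookup F e then cost e else 0ℚ)

  Feasible : Subset m → Set
  Feasible F = ∀ {a b} → (a , b) ∈ D → Conn (EdgeLink (In F)) a b

  Optimal : Subset m → Set
  Optimal F = Feasible F × (∀ F' → Feasible F' → costOf F ≤ costOf F')

  InclMinimal : Subset m → Set
  InclMinimal F = ∀ F' → (∀ e → In F' e → In F e) → Feasible F' → F' ≡ F

  -- The ε-extended moat-growing algorithm, as an event-driven run.
  -- A phase (Δ , As) records that every set in As was an active
  -- component during a time interval of length Δ.  Budgets are recorded
  -- as a list of contributions (S , x): the budget of a current component
  -- C is the sum of contributions of sets S ⊆ C (components only grow,
  -- so this realises "merged components' budgets are summed").

  Phase : Set
  Phase = ℚ × List (Subset n)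

  record State : Set where
    constructor st
    field
      hist : List Phase
      bud  : List (Subset n × ℚ)
  open State public

  ySum : List Phase → (Subset n → Bool) → ℚ
  ySum H p = ΣL H (λ ph → proj₁ ph * ΣL (proj₂ ph) (λ A → if p A then 1ℚ else 0ℚ))

  y : List Phase → Subset n → ℚ
  y H S = ySum H (sameSet S)

  load : List Phase → Fin m → ℚ
  load H e = ySum H (λ A → crossB A e)

  Tight : List Phase → Fin m → Set
  Tight H e = load H e ≡ cost e

  ConnT : List Phase → Fin n → Fin n → Set
  ConnT H = Conn (EdgeLink (Tight H))

  IsComp : List Phase → Subset n → Set
  IsComp H C = ∃ λ v → ∀ u → (In C u → ConnT H v u) × (ConnT H v u → In C u)

  budget : List (Subset n × ℚ) → Subset n → ℚ
  budget Bd C = ΣL Bd (λ sx → if subB (proj₁ sx) C then proj₂ sx else 0ℚ)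

  DemandActive : List Phase → Subset n → Set
  DemandActive H C = ∃ λ a → ∃ λ b → (a , b) ∈ D ×
    ((In C a × ¬ ConnT H a b) ⊎ (In C b × ¬ ConnT H b a))

  BudgetActive : State → Subset n → Set
  BudgetActive s C = ¬ DemandActive (hist s) C × 0ℚ < budget (bud s) C

  Active : State → Subset n → Set
  Active s C = DemandActive (hist s) C ⊎ BudgetActive s C

  -- One phase of the algorithm: Ds = demand-active components,
  -- Bs = budget-active components, Δ = time until the next event
  -- (an edge becoming tight or a budget reaching 0).
  data Step (ε : ℚ) : State → State → Set where
    step : ∀ {H Bd} (Ds Bs : List (Subset n)) (Δ : ℚ) →
      Unique Ds → Unique Bs →
      (∀ {C} → C ∈ Ds → IsComp H C × DemandActive H C) →
      (∀ C → IsComp H C → DemandActive H C → C ∈ Ds) →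
      (∀ {C} → C ∈ Bs → IsComp H C × BudgetActive (st H Bd) C) →
      (∀ C → IsComp H C → BudgetActive (st H Bd) C → C ∈ Bs) →
      0ℚ < Δ →
      let H'  = (Δ , Ds ++ Bs) ∷ H
          Bd' = map (λ C → (C , ε * Δ)) Ds ++ map (λ C → (C , - Δ)) Bs ++ Bd
      in
      (∀ e → load H' e ≤ cost e) →
      (∀ {C} → C ∈ Bs → 0ℚ ≤ budget Bd' C) →
      ((∃ λ e → (∃ λ C → C ∈ (Ds ++ Bs) × crossB C e ≡ true) × load H' e ≡ cost e)
        ⊎ (∃ λ C → C ∈ Bs × budget Bd' C ≡ 0ℚ)) →
      Step ε (st H Bd) (st H' Bd')

  data Reachable (ε : ℚ) : State → Set where
    init : Reachable ε (st [] [])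
    next : ∀ {s s'} → Reachable ε s → Step ε s s' → Reachable ε s'

  Terminal : State → Set
  Terminal s = ∀ C → IsComp (hist s) C → ¬ Active s C

  FinalRun : ℚ → State → Set
  FinalRun ε s = Reachable ε s × Terminal s

  CoActive : List Phase → List (Subset n) → Set
  CoActive H As = ∃ λ ph → ph ∈ H × (∀ {A} → A ∈ As → A ∈ proj₂ ph)

  Disjoint : Subset n → Subset n → Set
  Disjoint A B = ∀ v → In A v → lookup B v ≡ false

  SepEq : Subset n → Subset n → Set
  SepEq A B = ∀ {d} → d ∈ D → sepB A d ≡ sepB B d

  SepNonEmpty : Subset n → Set
  SepNonEmpty A = ∃ λ d → d ∈ D × sepB A d ≡ true

  SepMeet : Subset n → Subset n → Set
  SepMeet A B = ∃ λ d → d ∈ D × sepB A d ≡ true × sepB B d ≡ true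

  AutarkicPair : List Phase → Subset n → Subset n → Set
  AutarkicPair H A B =
    0ℚ < y H A × 0ℚ < y H B × Disjoint A B × CoActive H (A ∷ B ∷ []) ×
    SepEq A B × SepNonEmpty A

  AutarkicTriple : List Phase → Subset n → Subset n → Subset n → Set
  AutarkicTriple H A₁ A₂ A₃ =
    Disjoint A₁ A₂ × Disjoint A₁ A₃ × Disjoint A₂ A₃ ×
    CoActive H (A₁ ∷ A₂ ∷ A₃ ∷ []) ×
    SepNonEmpty A₁ × SepNonEmpty A₂ × SepNonEmpty A₃ ×
    (∀ {d} → d ∈ D → sepB (A₁ ∪ A₂ ∪ A₃) d ≡ false)
    where open Data.Fin.Subset using (_∪_)

  -- Members of an autarkic collection, together with their connector data:
  -- a pair carries its designated demand pair (a , b); a triple carries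
  -- for each index pair {i,j} an optional designated demand pair, and an
  -- edge set T (the chosen minimum-cost Steiner tree).
  data Member : Set where
    pairM   : (A B : Subset n) (a b : Fin n) → Member
    tripleM : (A₁ A₂ A₃ : Subset n) (d₁₂ d₁₃ d₂₃ : Maybe (Fin n × Fin n))
              (T : Subset m) → Member

  Designated : Subset n → Subset n → Maybe (Fin n × Fin n) → Set
  Designated A B nothing  = ¬ SepMeet A B
  Designated A B (just d) = d ∈ D × sepB A d ≡ true × sepB B d ≡ true

  termsOf : Maybe (Fin n × Fin n) → List (Fin n)
  termsOf nothing        = []
  termsOf (just (a , b)) = a ∷ b ∷ []

  TreeVertex : List (Fin n) → Subset m → Fin n → Set
  TreeVertex Ts T v = v ∈ Ts ⊎
    (∃ λ e → In T e × (proj₁ (ends e) ≡ v ⊎ proj₂ (ends e) ≡ v))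

  SteinerTree : List (Fin n) → Subset m → Set
  SteinerTree Ts T =
    (∀ u v → TreeVertex Ts T u → TreeVertex Ts T v → Conn (EdgeLink (In T)) u v) ×
    (∀ e → In T e →
       ¬ Conn (EdgeLink (λ e' → In T e' × e' ≢ e)) (proj₁ (ends e)) (proj₂ (ends e)))

  MinSteinerTree : List (Fin n) → Subset m → Set
  MinSteinerTree Ts T = SteinerTree Ts T × (∀ T' → SteinerTree Ts T' → costOf T ≤ costOf T')

  tripleTerms : Maybe (Fin n × Fin n) → Maybe (Fin n × Fin n) → Maybe (Fin n × Fin n) → List (Fin n)
  tripleTerms d₁₂ d₁₃ d₂₃ = termsOf d₁₂ ++ termsOf d₁₃ ++ termsOf d₂₃

  ValidMember : List Phase → Member → Set
  ValidMember H (pairM A B a b) =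
    AutarkicPair H A B × (a , b) ∈ D × sepB A (a , b) ≡ true
  ValidMember H (tripleM A₁ A₂ A₃ d₁₂ d₁₃ d₂₃ T) =
    AutarkicTriple H A₁ A₂ A₃ ×
    Designated A₁ A₂ d₁₂ × Designated A₁ A₃ d₁₃ × Designated A₂ A₃ d₂₃ ×
    MinSteinerTree (tripleTerms d₁₂ d₁₃ d₂₃) T

  sepM : Member → Fin n × Fin n → Bool
  sepM (pairM A B a b) d = sepB A d
  sepM (tripleM A₁ A₂ A₃ _ _ _ _) d = sepB A₁ d ∨ sepB A₂ d ∨ sepB A₃ d

  setsOf : Member → List (Subset n)
  setsOf (pairM A B _ _) = A ∷ B ∷ []
  setsOf (tripleM A₁ A₂ A₃ _ _ _ _) = A₁ ∷ A₂ ∷ A₃ ∷ []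

  CrossingFree : ∀ {k} → (Fin k → Member) → Set
  CrossingFree 𝒫 = ∀ i j → i ≢ j → ∀ {d} → d ∈ D →
    ¬ (sepM (𝒫 i) d ≡ true × sepM (𝒫 j) d ≡ true)

  coveredB : ∀ {k} → (Fin k → Member) → Subset n → Bool
  coveredB 𝒫 U = anyF (λ i → anyL (setsOf (𝒫 i))
                   (λ A → allL D (λ d → eqB (sepB U d) (sepB A d))))

  coverage : ∀ {k} → List Phase → (Fin k → Member) → ℚ
  coverage H 𝒫 = ySum H (coveredB 𝒫)

  ConnectorVertex : Member → Fin n → Set
  ConnectorVertex (pairM A B a b) v = v ≡ a ⊎ v ≡ b
  ConnectorVertex (tripleM _ _ _ d₁₂ d₁₃ d₂₃ T) v = TreeVertex (tripleTerms d₁₂ d₁₃ d₂₃) T v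

  -- feasibility in the contracted instance I/𝒫: every demand pair is
  -- connected using edges of F and identifications of connector vertices
  FeasibleContracted : ∀ {k} → (Fin k → Member) → Subset m → Set
  FeasibleContracted 𝒫 F = ∀ {a b} → (a , b) ∈ D →
    Conn (λ u v → EdgeLink (In F) u v ⊎
                  (∃ λ i → ConnectorVertex (𝒫 i) u × ConnectorVertex (𝒫 i) v)) a b

  multiCrossB : Subset m → Subset n → Bool
  multiCrossB OPT S = 2 ≤ᵇ countF (λ e → lookup OPT e ∧ crossB S e)

{-# OPTIONS --safe #-}
-- Let F be OPT minus the unique OPT-edge of every covered set U crossed by exactly one
-- OPT-edge (a lonely cut).  Cost: a covered U is crossed by OPT, since it separates a demand
-- pair; so either |OPT ∩ δ(U)| ≥ 2, or the OPT-edge of U is removed and y_U is part of its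
-- load, which is at most its cost.  Hence coverage ≤ Σ_{|OPT∩δ(S)|≥2} y_S + c(OPT ∖ F).
-- Feasibility: removing the edge of a lonely cut that does not separate u from v keeps u and v
-- connected.  If a lonely cut U₀ separates s from t, then U₀ matches a set of some member P;
-- a designated pair {a,b} of P is separated by exactly the same covered sets as {s,t}
-- (other members are crossing-free), and cutting the OPT-walks s–t and a–b at the edge of U₀
-- matches s, t with a, b through F.  The connector of P then joins a and b.

module Submission where

open import Defs
open import Function using (_∘_)
open import Data.Nat using (ℕ; zero; suc)
import Data.Nat as ℕ
import Data.Nat.Properties as ℕₚ
open import Data.Fin using (Fin) renaming (zero to fzero; suc to fsuc)
import Data.Fin as Fin
open import Data.Fin.Subset using (Subset; _∪_)
open import Data.Fin.Subset.Properties using (anySubset?)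
open import Data.Vec using (lookup; tabulate)
open import Data.Vec.Properties using (lookup∘tabulate; lookup-zipWith)
open import Data.Bool using (Bool; true; false; if_then_else_; _xor_; _∧_; _∨_; not)
import Data.Bool as Bool
import Data.Bool.Properties as Boolₚ
open import Data.Maybe using (just; nothing)
open import Data.List using (List; []; _∷_; allFin)
open import Data.List.Membership.Propositional using (_∈_)
open import Data.List.Membership.Propositional.Properties using (∈-++⁺ˡ; ∈-++⁺ʳ; ∈-allFin)
open import Data.List.Relation.Unary.Any using (here; there)
open import Data.List.Relation.Unary.All using (All; []; _∷_)
import Data.List.Relation.Unary.All as All
open import Data.Product using (∃; ∃₂; _×_; _,_; proj₁; proj₂; map₁; map₂)
open import Data.Sum using (_⊎_; inj₁; inj₂)
import Data.Sum as Sum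
open import Data.Empty using (⊥-elim)
open import Relation.Nullary using (¬_; yes; no; does)
open import Relation.Nullary.Decidable using (_×-dec_; dec-true; dec-false)
open import Relation.Unary using (Decidable)
open import Relation.Binary.PropositionalEquality
  using (_≡_; _≢_; refl; sym; trans; cong; cong₂; subst; module ≡-Reasoning)
open import Algebra.Bundles using (CommutativeMonoid; CommutativeRing)
open import Algebra.Properties.CommutativeSemigroup using (interchange)
open import Data.Rational using (ℚ; 0ℚ; 1ℚ; _+_; _*_; _-_; -_; _≤_)
import Data.Rational as ℚ
import Data.Rational.Properties as ℚₚ
open import Data.Rational.Solver using (module +-*-Solver)

xor≡false⇒≡ : ∀ {x y} → x xor y ≡ false → x ≡ y
xor≡false⇒≡ {false} {false} _  = refl
xor≡false⇒≡ {false} {true}  ()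
xor≡false⇒≡ {true}  {false} ()
xor≡false⇒≡ {true}  {true}  _  = refl

xor≡true⇒≢ : ∀ {x y} → x xor y ≡ true → x ≢ y
xor≡true⇒≢ {false} () refl
xor≡true⇒≢ {true}  () refl

xor-cancelˡ : ∀ x {y z} → x xor y ≡ x xor z → y ≡ z
xor-cancelˡ false eq = eq
xor-cancelˡ true  eq = Boolₚ.not-injective eq

xor-cancelʳ : ∀ {x y} z → x xor z ≡ y xor z → x ≡ y
xor-cancelʳ {x} {y} z eq =
  xor-cancelˡ z (trans (Boolₚ.xor-comm z x) (trans eq (Boolₚ.xor-comm y z)))

xor-≢ : ∀ {x y x′ y′} → x xor y ≡ x′ xor y′ → x ≢ x′ → y ≢ y′
xor-≢ eq x≢x′ refl = x≢x′ (xor-cancelʳ _ eq)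

xor-interchange : ∀ w x y z → (w xor x) xor (y xor z) ≡ (w xor y) xor (x xor z)
xor-interchange = interchange (CommutativeRing.+-commutativeSemigroup Boolₚ.xor-∧-commutativeRing)

∨≡xor : ∀ {x y} → (x ≡ true → y ≡ false) → x ∨ y ≡ x xor y
∨≡xor {false} _ = refl
∨≡xor {true}  h rewrite h refl = refl

∨≡true⇒ : ∀ x {y} → x ∨ y ≡ true → x ≡ true ⊎ y ≡ true
∨≡true⇒ true  _ = inj₁ refl
∨≡true⇒ false h = inj₂ h

eqB⇒≡ : ∀ {x y} → eqB x y ≡ true → x ≡ y
eqB⇒≡ {false} {false} _  = refl
eqB⇒≡ {false} {true}  ()
eqB⇒≡ {true}  {false} ()
eqB⇒≡ {true}  {true}  _  = refl

xor₃≡false⇒ : ∀ {x y z} → x xor (y xor z) ≡ false →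
  (x ≡ y xor z) × (y ≡ x xor z) × (z ≡ x xor y)
xor₃≡false⇒ {false} {false} {false} _ = refl , refl , refl
xor₃≡false⇒ {false} {false} {true}  ()
xor₃≡false⇒ {false} {true}  {false} ()
xor₃≡false⇒ {false} {true}  {true}  _ = refl , refl , refl
xor₃≡false⇒ {true}  {false} {false} ()
xor₃≡false⇒ {true}  {false} {true}  _ = refl , refl , refl
xor₃≡false⇒ {true}  {true}  {false} _ = refl , refl , refl
xor₃≡false⇒ {true}  {true}  {true}  ()

twoOfThree : ∀ x y z → x xor (y xor z) ≡ false → x ∨ (y ∨ z) ≡ true →
  (x ≡ true × y ≡ true) ⊎ (x ≡ true × z ≡ true) ⊎ (y ≡ true × z ≡ true)
twoOfThree true  true  _     _  _  = inj₁ (refl , refl)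
twoOfThree true  false true  _  _  = inj₂ (inj₁ (refl , refl))
twoOfThree false true  true  _  _  = inj₂ (inj₂ (refl , refl))
twoOfThree true  false false () _
twoOfThree false true  false () _
twoOfThree false false true  () _
twoOfThree false false false _  ()

anyF-sound : ∀ {k} (f : Fin k → Bool) → anyF f ≡ true → ∃ λ i → f i ≡ true
anyF-sound {zero}  f ()
anyF-sound {suc k} f h with ∨≡true⇒ (f fzero) h
... | inj₁ p = fzero , p
... | inj₂ p with anyF-sound (f ∘ fsuc) p
...   | i , q = fsuc i , q

anyL-sound : ∀ {A : Set} (xs : List A) f → anyL xs f ≡ true → ∃ λ x → x ∈ xs × f x ≡ true
anyL-sound []       f ()
anyL-sound (x ∷ xs) f h with ∨≡true⇒ (f x) h
... | inj₁ p = x , here refl , p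
... | inj₂ p = map₂ (map₁ there) (anyL-sound xs f p)

allL-sound : ∀ {A : Set} (xs : List A) f → allL xs f ≡ true → ∀ {x} → x ∈ xs → f x ≡ true
allL-sound (x ∷ xs) f h (here refl) = Boolₚ.∧-conicalˡ (f x) _ h
allL-sound (x ∷ xs) f h (there x∈) = allL-sound xs f (Boolₚ.∧-conicalʳ (f x) _ h) x∈

countF-pos : ∀ {k} (f : Fin k → Bool) i → f i ≡ true → countF f ≢ 0
countF-pos f fzero    fi eq rewrite fi with () ← eq
countF-pos f (fsuc i) fi eq with f fzero
... | true  with () ← eq
... | false = countF-pos (f ∘ fsuc) i fi eq

countF-witness : ∀ {k} (f : Fin k → Bool) → countF f ≢ 0 → ∃ λ i → f i ≡ true
countF-witness {zero}  f ≢0 = ⊥-elim (≢0 refl)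
countF-witness {suc k} f ≢0 with f fzero in f0
... | true  = fzero , f0
... | false with countF-witness (f ∘ fsuc) ≢0
...   | i , q = fsuc i , q

countF-unique : ∀ {k} (f : Fin k → Bool) → countF f ≡ 1 →
  ∀ {i j} → f i ≡ true → f j ≡ true → i ≡ j
countF-unique f c {fzero} {fzero} _ _ = refl
countF-unique f c {fzero} {fsuc j} fi fj rewrite fi =
  ⊥-elim (countF-pos (f ∘ fsuc) j fj (ℕₚ.suc-injective c))
countF-unique f c {fsuc i} {fzero} fi fj rewrite fj =
  ⊥-elim (countF-pos (f ∘ fsuc) i fi (ℕₚ.suc-injective c))
countF-unique f c {fsuc i} {fsuc j} fi fj with f fzero
... | true  = ⊥-elim (countF-pos (f ∘ fsuc) i fi (ℕₚ.suc-injective c))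
... | false = cong fsuc (countF-unique (f ∘ fsuc) c fi fj)

𝟙 : Bool → ℚ
𝟙 b = if b then 1ℚ else 0ℚ

0≤𝟙 : ∀ b → 0ℚ ≤ 𝟙 b
0≤𝟙 true  = ℚₚ.<⇒≤ (ℚₚ.positive⁻¹ 1ℚ)
0≤𝟙 false = ℚₚ.≤-refl

0≤+ : ∀ {x y} → 0ℚ ≤ x → 0ℚ ≤ y → 0ℚ ≤ x + y
0≤+ = ℚₚ.+-mono-≤

+-interchange : ∀ w x y z → (w + x) + (y + z) ≡ (w + y) + (x + z)
+-interchange = interchange (CommutativeMonoid.commutativeSemigroup ℚₚ.+-0-commutativeMonoid)

if-∧-split : ∀ (c : ℚ) o r →
  (if o then c else 0ℚ) ≡ (if o ∧ not r then c else 0ℚ) + (if o ∧ r then c else 0ℚ)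
if-∧-split c true  false = sym (ℚₚ.+-identityʳ c)
if-∧-split c true  true  = sym (ℚₚ.+-identityˡ c)
if-∧-split c false _     = refl

≤-slack : ∀ {a r o c μ} → o ≡ a + r → c ≤ μ + r → a ≤ (o - c) + μ
≤-slack {a} {r} {_} {c} {μ} refl c≤μ+r = begin
  a                  ≡⟨ ℚₚ.+-identityʳ a ⟨
  a + 0ℚ             ≡⟨ cong (a +_) (ℚₚ.+-inverseʳ c) ⟨
  a + (c - c)        ≤⟨ ℚₚ.+-monoʳ-≤ a (ℚₚ.+-monoˡ-≤ (- c) c≤μ+r) ⟩
  a + ((μ + r) - c)  ≡⟨ solve 4 (λ a r c μ → a :+ ((μ :+ r) :- c) := ((a :+ r) :- c) :+ μ)
                             refl a r c μ ⟩
  ((a + r) - c) + μ  ∎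
  where
  open ℚₚ.≤-Reasoning
  open +-*-Solver

module _ {A : Set} where

  ΣL-cong : ∀ (xs : List A) {f g} → (∀ x → f x ≡ g x) → ΣL xs f ≡ ΣL xs g
  ΣL-cong []       f≡g = refl
  ΣL-cong (x ∷ xs) f≡g = cong₂ _+_ (f≡g x) (ΣL-cong xs f≡g)

  ΣL-mono : ∀ (xs : List A) {f g} → (∀ {x} → x ∈ xs → f x ≤ g x) → ΣL xs f ≤ ΣL xs g
  ΣL-mono []       f≤g = ℚₚ.≤-refl
  ΣL-mono (x ∷ xs) f≤g = ℚₚ.+-mono-≤ (f≤g (here refl)) (ΣL-mono xs (f≤g ∘ there))

  ΣL-0 : ∀ (xs : List A) → ΣL xs (λ _ → 0ℚ) ≡ 0ℚ
  ΣL-0 []       = refl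
  ΣL-0 (x ∷ xs) = trans (ℚₚ.+-identityˡ _) (ΣL-0 xs)

  ΣL-+ : ∀ (xs : List A) f g → ΣL xs (λ x → f x + g x) ≡ ΣL xs f + ΣL xs g
  ΣL-+ []       f g = refl
  ΣL-+ (x ∷ xs) f g =
    trans (cong (f x + g x +_) (ΣL-+ xs f g)) (+-interchange (f x) (g x) _ _)

ΣF-cong : ∀ {k} {f g : Fin k → ℚ} → (∀ i → f i ≡ g i) → ΣF f ≡ ΣF g
ΣF-cong {zero}  f≡g = refl
ΣF-cong {suc k} f≡g = cong₂ _+_ (f≡g fzero) (ΣF-cong (f≡g ∘ fsuc))

ΣF-mono : ∀ {k} {f g : Fin k → ℚ} → (∀ i → f i ≤ g i) → ΣF f ≤ ΣF g
ΣF-mono {zero}  f≤g = ℚₚ.≤-refl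
ΣF-mono {suc k} f≤g = ℚₚ.+-mono-≤ (f≤g fzero) (ΣF-mono (f≤g ∘ fsuc))

ΣF-+ : ∀ {k} (f g : Fin k → ℚ) → ΣF (λ i → f i + g i) ≡ ΣF f + ΣF g
ΣF-+ {zero}  f g = refl
ΣF-+ {suc k} f g = trans (cong (f fzero + g fzero +_) (ΣF-+ (f ∘ fsuc) (g ∘ fsuc)))
                         (+-interchange (f fzero) (g fzero) _ _)

ΣF-nonneg : ∀ {k} {f : Fin k → ℚ} → (∀ i → 0ℚ ≤ f i) → 0ℚ ≤ ΣF f
ΣF-nonneg {zero}  0≤f = ℚₚ.≤-refl
ΣF-nonneg {suc k} 0≤f = 0≤+ (0≤f fzero) (ΣF-nonneg (0≤f ∘ fsuc))

ΣF-≥-term : ∀ {k} {f : Fin k → ℚ} → (∀ i → 0ℚ ≤ f i) → ∀ i → f i ≤ ΣF f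
ΣF-≥-term {f = f} 0≤f fzero = begin
  f fzero            ≡⟨ ℚₚ.+-identityʳ (f fzero) ⟨
  f fzero + 0ℚ       ≤⟨ ℚₚ.+-monoʳ-≤ (f fzero) (ΣF-nonneg (0≤f ∘ fsuc)) ⟩
  ΣF f               ∎
  where open ℚₚ.≤-Reasoning
ΣF-≥-term {f = f} 0≤f (fsuc i) = begin
  f (fsuc i)         ≡⟨ ℚₚ.+-identityˡ (f (fsuc i)) ⟨
  0ℚ + f (fsuc i)    ≤⟨ ℚₚ.+-mono-≤ (0≤f fzero) (ΣF-≥-term (0≤f ∘ fsuc) i) ⟩
  ΣF f               ∎
  where open ℚₚ.≤-Reasoning

module _ {X : Set} where

  yΣ : List (ℚ × List X) → (X → ℚ) → ℚ
  yΣ H g = ΣL H (λ ph → proj₁ ph * ΣL (proj₂ ph) g)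

  yΣ-0 : ∀ H → yΣ H (λ _ → 0ℚ) ≡ 0ℚ
  yΣ-0 H = trans (ΣL-cong H (λ ph → trans (cong (proj₁ ph *_) (ΣL-0 (proj₂ ph)))
                                           (ℚₚ.*-zeroʳ (proj₁ ph))))
                 (ΣL-0 H)

  yΣ-+ : ∀ H g g′ → yΣ H (λ x → g x + g′ x) ≡ yΣ H g + yΣ H g′
  yΣ-+ H g g′ = trans (ΣL-cong H (λ ph → trans (cong (proj₁ ph *_) (ΣL-+ (proj₂ ph) g g′))
                                               (ℚₚ.*-distribˡ-+ (proj₁ ph) _ _)))
                      (ΣL-+ H _ _)

  yΣ-mono : ∀ H {g g′} → (∀ {ph} → ph ∈ H → 0ℚ ≤ proj₁ ph) → (∀ x → g x ≤ g′ x) →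
            yΣ H g ≤ yΣ H g′
  yΣ-mono H 0≤Δ g≤g′ = ΣL-mono H λ {ph} ph∈H →
    let instance _ = ℚ.nonNegative (0≤Δ ph∈H)
    in ℚₚ.*-monoˡ-≤-nonNeg (proj₁ ph) (ΣL-mono (proj₂ ph) (λ {x} _ → g≤g′ x))

  ΣF-yΣ : ∀ H {k} (g : Fin k → X → ℚ) → ΣF (λ i → yΣ H (g i)) ≡ yΣ H (λ x → ΣF (λ i → g i x))
  ΣF-yΣ H {zero}  g = sym (yΣ-0 H)
  ΣF-yΣ H {suc k} g = trans (cong (yΣ H (g fzero) +_) (ΣF-yΣ H (g ∘ fsuc)))
                            (sym (yΣ-+ H (g fzero) _))

module _ {V : Set} where

  Conn-mono : ∀ {L L′ : V → V → Set} → (∀ {u v} → L u v → L′ u v) →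
              ∀ {u v} → Conn L u v → Conn L′ u v
  Conn-mono f here        = here
  Conn-mono f (step→ l c) = step→ (f l) (Conn-mono f c)
  Conn-mono f (step← l c) = step← (f l) (Conn-mono f c)

  Conn-trans : ∀ {L : V → V → Set} {u v w} → Conn L u v → Conn L v w → Conn L u w
  Conn-trans here        d = d
  Conn-trans (step→ l c) d = step→ l (Conn-trans c d)
  Conn-trans (step← l c) d = step← l (Conn-trans c d)

  Conn-sym : ∀ {L : V → V → Set} {u v} → Conn L u v → Conn L v u
  Conn-sym here        = here
  Conn-sym (step→ l c) = Conn-trans (Conn-sym c) (step← l here)
  Conn-sym (step← l c) = Conn-trans (Conn-sym c) (step→ l here)

module Graph (I : Instance) where
  open Instance I

  Connected : (Fin m → Set) → Fin n → Fin n → Set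
  Connected P = Conn (EdgeLink I P)

  _∖_ : (Fin m → Set) → Fin m → Fin m → Set
  (P ∖ e) e′ = P e′ × e′ ≢ e

  Avoids : (Fin m → Set) → Subset n → Set
  Avoids P U = ∀ e → P e → crossB I U e ≡ false

  Connected-mono : ∀ {P P′ : Fin m → Set} → (∀ {e} → P e → P′ e) →
                   ∀ {u v} → Connected P u v → Connected P′ u v
  Connected-mono P⊆P′ = Conn-mono (λ (e , pe , eq) → e , P⊆P′ pe , eq)

  crossB-ends : ∀ U {e u w} → ends e ≡ (u , w) → crossB I U e ≡ lookup U u xor lookup U w
  crossB-ends U eq rewrite eq = refl

  ends-sameSide : ∀ U {e u w} → ends e ≡ (u , w) → crossB I U e ≡ false → lookup U u ≡ lookup U w
  ends-sameSide U eq cr = xor≡false⇒≡ (trans (sym (crossB-ends U eq)) cr)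

  Avoids⇒sameSide : ∀ {P U} → Avoids P U → ∀ {u v} → Connected P u v → lookup U u ≡ lookup U v
  Avoids⇒sameSide {U = U} av = go
    where
    link : ∀ {u w} → EdgeLink I _ u w → lookup U u ≡ lookup U w
    link (e , pe , eq) = ends-sameSide U eq (av e pe)

    go : ∀ {u v} → Connected _ u v → lookup U u ≡ lookup U v
    go here        = refl
    go (step→ l c) = trans (link l) (go c)
    go (step← l c) = trans (sym (link l)) (go c)

  crossing-edge : ∀ {P} U {u v} → Connected P u v → lookup U u ≢ lookup U v →
    ∃ λ e → P e × crossB I U e ≡ true × Connected P u (proj₁ (ends e))
  crossing-edge U here u≢v = ⊥-elim (u≢v refl)
  crossing-edge U (step→ l@(e , pe , eq) c) u≢v with crossB I U e in cr
  ... | true  = e , pe , cr , subst (Connected _ _) (sym (cong proj₁ eq)) here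
  ... | false with crossing-edge U c (u≢v ∘ trans (ends-sameSide U eq cr))
  ...   | e′ , pe′ , cr′ , w~e′ = e′ , pe′ , cr′ , step→ l w~e′
  crossing-edge U (step← l@(e , pe , eq) c) u≢v with crossB I U e in cr
  ... | true  = e , pe , cr , subst (Connected _ _) (sym (cong proj₁ eq)) (step← l here)
  ... | false with crossing-edge U c (u≢v ∘ trans (sym (ends-sameSide U eq cr)))
  ...   | e′ , pe′ , cr′ , w~e′ = e′ , pe′ , cr′ , step← l w~e′

  Split : (Fin m → Set) → Fin m → (p q u v : Fin n) → Set
  Split P e p q u v = Connected (P ∖ e) u v
                    ⊎ (Connected (P ∖ e) u p × Connected (P ∖ e) q v)
                    ⊎ (Connected (P ∖ e) u q × Connected (P ∖ e) p v)

  Split-cons : ∀ {P e p q u w v} → Connected (P ∖ e) u w → Split P e p q w v → Split P e p q u v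
  Split-cons u~w = Sum.map (Conn-trans u~w)
                           (Sum.map (map₁ (Conn-trans u~w)) (map₁ (Conn-trans u~w)))

  Connected⇒Split : ∀ {P} e {p q} → ends e ≡ (p , q) → ∀ {u v} → Connected P u v → Split P e p q u v
  Connected⇒Split {P} e {p} {q} ends≡ = go
    where
    go : ∀ {u v} → Connected P u v → Split P e p q u v
    go here = inj₁ here
    go (step→ (e′ , pe′ , eq) c) with e′ Fin.≟ e
    ... | no e′≢e = Split-cons (step→ (e′ , (pe′ , e′≢e) , eq) here) (go c)
    ... | yes refl with trans (sym ends≡) eq | go c
    ...   | refl | inj₁ q~v                 = inj₂ (inj₁ (here , q~v))
    ...   | refl | inj₂ (inj₁ (_ , q~v))    = inj₂ (inj₁ (here , q~v))
    ...   | refl | inj₂ (inj₂ (_ , p~v))    = inj₁ p~v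
    go (step← (e′ , pe′ , eq) c) with e′ Fin.≟ e
    ... | no e′≢e = Split-cons (step← (e′ , (pe′ , e′≢e) , eq) here) (go c)
    ... | yes refl with trans (sym ends≡) eq | go c
    ...   | refl | inj₁ p~v                 = inj₂ (inj₂ (here , p~v))
    ...   | refl | inj₂ (inj₁ (_ , q~v))    = inj₁ q~v
    ...   | refl | inj₂ (inj₂ (_ , p~v))    = inj₂ (inj₂ (here , p~v))

  module _ {P : Fin m → Set} {U : Subset n} {e : Fin m}
           (e-crosses : crossB I U e ≡ true) (avoids : Avoids (P ∖ e) U) where

    private
      side : ∀ {u v} → Connected (P ∖ e) u v → lookup U u ≡ lookup U v
      side = Avoids⇒sameSide {P ∖ e} {U} avoids

      p≢q : lookup U (proj₁ (ends e)) ≢ lookup U (proj₂ (ends e))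
      p≢q = xor≡true⇒≢ e-crosses

    cut-sameSide : ∀ {u v} → Connected P u v → lookup U u ≡ lookup U v → Connected (P ∖ e) u v
    cut-sameSide u~v u≡v with Connected⇒Split e refl u~v
    ... | inj₁ u~v′ = u~v′
    ... | inj₂ (inj₁ (u~p , q~v)) =
      ⊥-elim (p≢q (trans (sym (side u~p)) (trans u≡v (sym (side q~v)))))
    ... | inj₂ (inj₂ (u~q , p~v)) =
      ⊥-elim (p≢q (trans (side p~v) (trans (sym u≡v) (side u~q))))

    cut-split : ∀ {u v} → Connected P u v → lookup U u ≢ lookup U v →
      (Connected (P ∖ e) u (proj₁ (ends e)) × Connected (P ∖ e) (proj₂ (ends e)) v) ⊎
      (Connected (P ∖ e) u (proj₂ (ends e)) × Connected (P ∖ e) (proj₁ (ends e)) v)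
    cut-split u~v u≢v with Connected⇒Split e refl u~v
    ... | inj₁ u~v′ = ⊥-elim (u≢v (side u~v′))
    ... | inj₂ s    = s

-- Pruning the lonely edges of a family of cuts

module Pruning (I : Instance) (OPT : Subset (Instance.m I))
               (Cut : Subset (Instance.n I) → Set) (Cut? : Decidable Cut) where
  open Instance I
  open Graph I

  crossesOPT : Subset n → Fin m → Bool
  crossesOPT U e = lookup OPT e ∧ crossB I U e

  Lonely : Subset n → Set
  Lonely U = countF (crossesOPT U) ≡ 1

  lonely? : Decidable Lonely
  lonely? U = countF (crossesOPT U) ℕ.≟ 1

  Removable : Fin m → Set
  Removable e = ∃ λ U → Cut U × Lonely U × crossesOPT U e ≡ true

  removable? : Decidable Removable
  removable? e = anySubset? λ U → Cut? U ×-dec lonely? U ×-dec crossesOPT U e Bool.≟ true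

  removed : Fin m → Bool
  removed e = lookup OPT e ∧ does (removable? e)

  pruned : Subset m
  pruned = tabulate λ e → lookup OPT e ∧ not (does (removable? e))

  crossesOPT-intro : ∀ {U e} → In I OPT e → crossB I U e ≡ true → crossesOPT U e ≡ true
  crossesOPT-intro o cr rewrite o | cr = refl

  lonely-edge : ∀ {U} → Lonely U → ∃ λ e → crossesOPT U e ≡ true
  lonely-edge l = countF-witness _ (λ c≡0 → ℕₚ.1+n≢0 (trans (sym l) c≡0))

  lonely-unique : ∀ {U e e′} → Lonely U → crossesOPT U e ≡ true → crossesOPT U e′ ≡ true → e ≡ e′
  lonely-unique l = countF-unique _ l

  lonely-avoids : ∀ {U e} → Lonely U → crossesOPT U e ≡ true → Avoids (In I OPT ∖ e) U
  lonely-avoids {U} l ce e′ (o , e′≢e) =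
    Boolₚ.¬-not {y = true} λ cr → e′≢e (lonely-unique {U} l (crossesOPT-intro {U} o cr) ce)

  Unseparated : Fin n → Fin n → Set
  Unseparated u v = ∀ U → Cut U → Lonely U → lookup U u ≡ lookup U v

  Kept : List (Fin m) → Fin m → Set
  Kept es e = In I OPT e × (e ∈ es → ¬ Removable e)

  Kept-connected : ∀ es {u v} → Connected (In I OPT) u v → Unseparated u v → Connected (Kept es) u v
  Kept-connected []       u~v _ = Connected-mono (λ o → o , λ ()) u~v
  Kept-connected (r ∷ es) u~v unsep with removable? r
  ... | yes (U , cut , lonely , r-crosses) =
    Connected-mono keep (cut-sameSide {U = U} (Boolₚ.∧-conicalʳ _ _ r-crosses) avoids
                                      (Kept-connected es u~v unsep) (unsep U cut lonely))
    where
    avoids : Avoids (Kept es ∖ r) U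
    avoids e ((o , _) , e≢r) = lonely-avoids {U} lonely r-crosses e (o , e≢r)

    keep : ∀ {e} → (Kept es ∖ r) e → Kept (r ∷ es) e
    keep ((o , k) , e≢r) = o , λ { (here refl) → ⊥-elim (e≢r refl) ; (there e∈) → k e∈ }
  ... | no ¬removable = Connected-mono keep (Kept-connected es u~v unsep)
    where
    keep : ∀ {e} → Kept es e → Kept (r ∷ es) e
    keep (o , k) = o , λ { (here refl) → ¬removable ; (there e∈) → k e∈ }

  pruned-connected : ∀ {u v} → Connected (In I OPT) u v → Unseparated u v →
                     Connected (In I pruned) u v
  pruned-connected u~v unsep = Connected-mono kept⇒pruned (Kept-connected (allFin m) u~v unsep)
    where
    kept⇒pruned : ∀ {e} → Kept (allFin m) e → In I pruned e
    kept⇒pruned {e} (o , k) = trans (lookup∘tabulate _ e)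
      (cong₂ (λ x y → x ∧ not y) o (dec-false (removable? e) (k (∈-allFin e))))

  CutsAgree : Fin n × Fin n → Fin n × Fin n → Set
  CutsAgree d d′ = ∀ U → Cut U → Lonely U → sepB I U d ≡ sepB I U d′

  CutsAgree-swap : ∀ {d a b} → CutsAgree d (a , b) → CutsAgree d (b , a)
  CutsAgree-swap {a = a} {b} agree U cut l =
    trans (agree U cut l) (Boolₚ.xor-comm (lookup U a) (lookup U b))

  -- The lonely edge of a cut separating s from a would lie on both walks, joining s to t.
  pruned-pairs : ∀ {U₀ e₀ s t a b} → Lonely U₀ → crossesOPT U₀ e₀ ≡ true →
    lookup U₀ s ≢ lookup U₀ t → CutsAgree (s , t) (a , b) →
    Connected (In I OPT ∖ e₀) s a → Connected (In I OPT ∖ e₀) t b →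
    Connected (In I pruned) s a × Connected (In I pruned) t b
  pruned-pairs {U₀} {e₀} {s} {t} {a} {b} l₀ c₀ s≢t agree s~a t~b =
    pruned-connected (Connected-mono proj₁ s~a) s|a ,
    pruned-connected (Connected-mono proj₁ t~b) t|b
    where
    s|a : Unseparated s a
    s|a U cut l with lookup U s Bool.≟ lookup U a
    ... | yes s≡a = s≡a
    ... | no  s≢a with crossing-edge U s~a s≢a | crossing-edge U t~b (xor-≢ (agree U cut l) s≢a)
    ...   | e₁ , (o₁ , _) , cr₁ , s~e₁ | e₂ , (o₂ , _) , cr₂ , t~e₂ =
      ⊥-elim (s≢t (Avoids⇒sameSide {U = U₀} (lonely-avoids {U₀} l₀ c₀) s~t))
      where
      e₁≡e₂ : e₁ ≡ e₂
      e₁≡e₂ = lonely-unique {U} l (crossesOPT-intro {U} o₁ cr₁) (crossesOPT-intro {U} o₂ cr₂)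

      s~t : Connected (In I OPT ∖ e₀) s t
      s~t = Conn-trans s~e₁
              (Conn-sym (subst (λ e → Connected _ t (proj₁ (ends e))) (sym e₁≡e₂) t~e₂))

    t|b : Unseparated t b
    t|b U cut l = xor-cancelˡ (lookup U a)
      (subst (λ x → x xor lookup U t ≡ lookup U a xor lookup U b) (s|a U cut l) (agree U cut l))

  pruned-sides : ∀ {U₀ s t a b} → Cut U₀ → Lonely U₀ → sepB I U₀ (s , t) ≡ true →
    Connected (In I OPT) s t → Connected (In I OPT) a b → CutsAgree (s , t) (a , b) →
    (Connected (In I pruned) s a × Connected (In I pruned) t b) ⊎
    (Connected (In I pruned) s b × Connected (In I pruned) t a)
  pruned-sides {U₀} {s} {t} {a} {b} cut₀ l₀ sep₀ s~t a~b agree =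
    combine (split s~t s≢t) (split a~b a≢b)
    where
    e₀ : Fin m
    e₀ = proj₁ (lonely-edge {U₀} l₀)

    c₀ : crossesOPT U₀ e₀ ≡ true
    c₀ = proj₂ (lonely-edge {U₀} l₀)

    p q : Fin n
    p = proj₁ (ends e₀)
    q = proj₂ (ends e₀)

    Q : Fin n → Fin n → Set
    Q = Connected (In I OPT ∖ e₀)

    s≢t : lookup U₀ s ≢ lookup U₀ t
    s≢t = xor≡true⇒≢ sep₀

    a≢b : lookup U₀ a ≢ lookup U₀ b
    a≢b = xor≡true⇒≢ (trans (sym (agree U₀ cut₀ l₀)) sep₀)

    split : ∀ {u v} → Connected (In I OPT) u v → lookup U₀ u ≢ lookup U₀ v →
            (Q u p × Q q v) ⊎ (Q u q × Q p v)
    split = cut-split {U = U₀} (Boolₚ.∧-conicalʳ _ _ c₀) (lonely-avoids {U₀} l₀ c₀)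

    Pruned : Fin n → Fin n → Set
    Pruned = Connected (In I pruned)

    straight : Q s a → Q t b → Pruned s a × Pruned t b
    straight = pruned-pairs {U₀} l₀ c₀ s≢t agree

    crossed : Q s b → Q t a → Pruned s b × Pruned t a
    crossed = pruned-pairs {U₀} l₀ c₀ s≢t (CutsAgree-swap agree)

    combine : (Q s p × Q q t) ⊎ (Q s q × Q p t) → (Q a p × Q q b) ⊎ (Q a q × Q p b) →
              (Pruned s a × Pruned t b) ⊎ (Pruned s b × Pruned t a)
    combine (inj₁ (s~p , q~t)) (inj₁ (a~p , q~b)) =
      inj₁ (straight (Conn-trans s~p (Conn-sym a~p)) (Conn-trans (Conn-sym q~t) q~b))
    combine (inj₁ (s~p , q~t)) (inj₂ (a~q , p~b)) =
      inj₂ (crossed (Conn-trans s~p p~b) (Conn-trans (Conn-sym q~t) (Conn-sym a~q)))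
    combine (inj₂ (s~q , p~t)) (inj₁ (a~p , q~b)) =
      inj₂ (crossed (Conn-trans s~q q~b) (Conn-trans (Conn-sym p~t) (Conn-sym a~p)))
    combine (inj₂ (s~q , p~t)) (inj₂ (a~q , p~b)) =
      inj₁ (straight (Conn-trans s~q (Conn-sym a~q)) (Conn-trans (Conn-sym p~t) p~b))

-- Autarkic pairs and triples

module Members (I : Instance) (H : List (Phase I)) where
  open Instance I

  sepB-∪ : ∀ A B → Disjoint I A B → ∀ d → sepB I (A ∪ B) d ≡ sepB I A d xor sepB I B d
  sepB-∪ A B A∩B≡∅ (s , t) = begin
    lookup (A ∪ B) s xor lookup (A ∪ B) t
      ≡⟨ cong₂ _xor_ (lookup-∪ s) (lookup-∪ t) ⟩
    (lookup A s xor lookup B s) xor (lookup A t xor lookup B t)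
      ≡⟨ xor-interchange (lookup A s) (lookup B s) (lookup A t) (lookup B t) ⟩
    (lookup A s xor lookup A t) xor (lookup B s xor lookup B t)
      ∎
    where
    open ≡-Reasoning
    lookup-∪ : ∀ v → lookup (A ∪ B) v ≡ lookup A v xor lookup B v
    lookup-∪ v = trans (lookup-zipWith _∨_ v A B) (∨≡xor (A∩B≡∅ v))

  Disjoint-∪ : ∀ {A} B C → Disjoint I A B → Disjoint I A C → Disjoint I A (B ∪ C)
  Disjoint-∪ B C A∩B≡∅ A∩C≡∅ v v∈A =
    trans (lookup-zipWith _∨_ v B C) (cong₂ _∨_ (A∩B≡∅ v v∈A) (A∩C≡∅ v v∈A))

  triple-parity : ∀ {A₁ A₂ A₃} → AutarkicTriple I H A₁ A₂ A₃ → ∀ {d} → d ∈ D →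
    sepB I A₁ d xor (sepB I A₂ d xor sepB I A₃ d) ≡ false
  triple-parity {A₁} {A₂} {A₃} (A₁∩A₂ , A₁∩A₃ , A₂∩A₃ , _ , _ , _ , _ , sep∪≡false) {d} d∈D = begin
    sepB I A₁ d xor (sepB I A₂ d xor sepB I A₃ d)
      ≡⟨ cong (sepB I A₁ d xor_) (sepB-∪ A₂ A₃ A₂∩A₃ d) ⟨
    sepB I A₁ d xor sepB I (A₂ ∪ A₃) d
      ≡⟨ sepB-∪ A₁ (A₂ ∪ A₃) (Disjoint-∪ {A₁} A₂ A₃ A₁∩A₂ A₁∩A₃) d ⟨
    sepB I (A₁ ∪ A₂ ∪ A₃) d
      ≡⟨ sep∪≡false d∈D ⟩
    false
      ∎
    where open ≡-Reasoning

  setsOf-sepM : ∀ M → ValidMember I H M → ∀ {A d} → A ∈ setsOf I M → d ∈ D →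
    sepB I A d ≡ true → sepM I M d ≡ true
  setsOf-sepM (pairM A B a b) _ (here refl) _ sep = sep
  setsOf-sepM (pairM A B a b) ((_ , _ , _ , _ , A≈B , _) , _) (there (here refl)) d∈D sep =
    trans (A≈B d∈D) sep
  setsOf-sepM (tripleM A₁ A₂ A₃ _ _ _ _) _ (here refl) _ sep rewrite sep = refl
  setsOf-sepM (tripleM A₁ A₂ A₃ _ _ _ _) _ (there (here refl)) _ sep rewrite sep =
    Boolₚ.∨-zeroʳ _
  setsOf-sepM (tripleM A₁ A₂ A₃ _ _ _ _) _ {d = d} (there (there (here refl))) _ sep
    rewrite sep | Boolₚ.∨-zeroʳ (sepB I A₂ d) = Boolₚ.∨-zeroʳ _

  setsOf-sepNonEmpty : ∀ M → ValidMember I H M → ∀ {A} → A ∈ setsOf I M → SepNonEmpty I A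
  setsOf-sepNonEmpty (pairM _ _ _ _) ((_ , _ , _ , _ , _ , ne) , _) (here refl) = ne
  setsOf-sepNonEmpty (pairM _ _ _ _) ((_ , _ , _ , _ , A≈B , (d , d∈D , sep)) , _)
                     (there (here refl)) = d , d∈D , trans (sym (A≈B d∈D)) sep
  setsOf-sepNonEmpty (tripleM _ _ _ _ _ _ _) ((_ , _ , _ , _ , ne , _) , _)
                     (here refl) = ne
  setsOf-sepNonEmpty (tripleM _ _ _ _ _ _ _) ((_ , _ , _ , _ , _ , ne , _) , _)
                     (there (here refl)) = ne
  setsOf-sepNonEmpty (tripleM _ _ _ _ _ _ _) ((_ , _ , _ , _ , _ , _ , ne , _) , _)
                     (there (there (here refl))) = ne

  Representative : Member I → Fin n × Fin n → Set
  Representative M d = ∃ λ d′ → d′ ∈ D ×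
    ConnectorVertex I M (proj₁ d′) × ConnectorVertex I M (proj₂ d′) ×
    All (λ A → sepB I A d ≡ sepB I A d′) (setsOf I M)

  designated-representative : ∀ {X Y} Z {dd d} → Designated I X Y dd →
    (∀ {d} → d ∈ D → sepB I Z d ≡ sepB I X d xor sepB I Y d) →
    d ∈ D → sepB I X d ≡ true → sepB I Y d ≡ true →
    ∃ λ d′ → d′ ∈ D × (proj₁ d′ ∈ termsOf I dd × proj₂ d′ ∈ termsOf I dd) ×
             (sepB I X d ≡ sepB I X d′ × sepB I Y d ≡ sepB I Y d′ × sepB I Z d ≡ sepB I Z d′)
  designated-representative _ {dd = nothing} ¬meet _ d∈D x y = ⊥-elim (¬meet (_ , d∈D , x , y))
  designated-representative {X} {Y} _ {dd = just d′} {d} (d′∈D , x′ , y′) parity d∈D x y =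
    d′ , d′∈D , (here refl , there (here refl)) , X≡ , Y≡ ,
    trans (parity d∈D) (trans (cong₂ _xor_ X≡ Y≡) (sym (parity d′∈D)))
    where
    X≡ : sepB I X d ≡ sepB I X d′
    X≡ = trans x (sym x′)

    Y≡ : sepB I Y d ≡ sepB I Y d′
    Y≡ = trans y (sym y′)

  triple-representative : ∀ {A₁ A₂ A₃ d₁₂ d₁₃ d₂₃ T} → AutarkicTriple I H A₁ A₂ A₃ →
    Designated I A₁ A₂ d₁₂ → Designated I A₁ A₃ d₁₃ → Designated I A₂ A₃ d₂₃ →
    ∀ {d} → d ∈ D → sepM I (tripleM A₁ A₂ A₃ d₁₂ d₁₃ d₂₃ T) d ≡ true →
    Representative (tripleM A₁ A₂ A₃ d₁₂ d₁₃ d₂₃ T) d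
  triple-representative {A₁} {A₂} {A₃} {d₁₂} {d₁₃} {d₂₃} {T} aut des₁₂ des₁₃ des₂₃ {d} d∈D sep-d =
    pick (twoOfThree _ _ _ (triple-parity aut d∈D) sep-d)
    where
    M : Member I
    M = tripleM A₁ A₂ A₃ d₁₂ d₁₃ d₂₃ T

    parity : ∀ {d} → d ∈ D →
      (sepB I A₁ d ≡ sepB I A₂ d xor sepB I A₃ d) ×
      (sepB I A₂ d ≡ sepB I A₁ d xor sepB I A₃ d) ×
      (sepB I A₃ d ≡ sepB I A₁ d xor sepB I A₂ d)
    parity d∈D = xor₃≡false⇒ (triple-parity aut d∈D)

    in₁₂ : ∀ {v} → v ∈ termsOf I d₁₂ → ConnectorVertex I M v
    in₁₂ = inj₁ ∘ ∈-++⁺ˡ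

    in₁₃ : ∀ {v} → v ∈ termsOf I d₁₃ → ConnectorVertex I M v
    in₁₃ = inj₁ ∘ ∈-++⁺ʳ (termsOf I d₁₂) ∘ ∈-++⁺ˡ

    in₂₃ : ∀ {v} → v ∈ termsOf I d₂₃ → ConnectorVertex I M v
    in₂₃ = inj₁ ∘ ∈-++⁺ʳ (termsOf I d₁₂) ∘ ∈-++⁺ʳ (termsOf I d₁₃)

    pick : (sepB I A₁ d ≡ true × sepB I A₂ d ≡ true) ⊎ (sepB I A₁ d ≡ true × sepB I A₃ d ≡ true) ⊎
           (sepB I A₂ d ≡ true × sepB I A₃ d ≡ true) → Representative M d
    pick (inj₁ (x , y)) with designated-representative A₃ des₁₂ (proj₂ ∘ proj₂ ∘ parity) d∈D x y
    ... | d′ , d′∈D , (a∈ , b∈) , (≡₁ , ≡₂ , ≡₃) =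
      d′ , d′∈D , in₁₂ a∈ , in₁₂ b∈ , ≡₁ ∷ ≡₂ ∷ ≡₃ ∷ []
    pick (inj₂ (inj₁ (x , z)))
      with designated-representative A₂ des₁₃ (proj₁ ∘ proj₂ ∘ parity) d∈D x z
    ... | d′ , d′∈D , (a∈ , b∈) , (≡₁ , ≡₃ , ≡₂) =
      d′ , d′∈D , in₁₃ a∈ , in₁₃ b∈ , ≡₁ ∷ ≡₂ ∷ ≡₃ ∷ []
    pick (inj₂ (inj₂ (y , z))) with designated-representative A₁ des₂₃ (proj₁ ∘ parity) d∈D y z
    ... | d′ , d′∈D , (a∈ , b∈) , (≡₂ , ≡₃ , ≡₁) =
      d′ , d′∈D , in₂₃ a∈ , in₂₃ b∈ , ≡₁ ∷ ≡₂ ∷ ≡₃ ∷ []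

  representative : ∀ M → ValidMember I H M → ∀ {d} → d ∈ D → sepM I M d ≡ true → Representative M d
  representative (pairM A B a b) ((_ , _ , _ , _ , A≈B , _) , ab∈D , sepA-ab) {d} d∈D sepA-d =
    (a , b) , ab∈D , inj₁ refl , inj₂ refl , agreeA ∷ agreeB ∷ []
    where
    agreeA : sepB I A d ≡ sepB I A (a , b)
    agreeA = trans sepA-d (sym sepA-ab)

    agreeB : sepB I B d ≡ sepB I B (a , b)
    agreeB = trans (sym (A≈B d∈D)) (trans agreeA (A≈B ab∈D))
  representative (tripleM _ _ _ _ _ _ T) (aut , des₁₂ , des₁₃ , des₂₃ , _) =
    triple-representative {T = T} aut des₁₂ des₁₃ des₂₃

-- The contracted instance

module Contraction (I : Instance) (H : List (Phase I)) {k} (𝒫 : Fin k → Member I)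
  (valid : ∀ i → ValidMember I H (𝒫 i)) (crossingFree : CrossingFree I 𝒫)
  (OPT : Subset (Instance.m I)) (OPT-feasible : Feasible I OPT) where
  open Instance I
  open Graph I
  open Members I H

  Covered : Subset n → Set
  Covered U = coveredB I 𝒫 U ≡ true

  covered? : Decidable Covered
  covered? U = coveredB I 𝒫 U Bool.≟ true

  -- Cuts range over all covered subsets of V, not only over supp(y): removing more edges
  -- only lowers c(F), and it makes removability decidable by enumerating subsets.
  open Pruning I OPT Covered covered? public

  covered⇒setOf : ∀ {U} → Covered U → ∃₂ λ i A → A ∈ setsOf I (𝒫 i) × SepEq I U A
  covered⇒setOf cov with anyF-sound _ cov
  ... | i , cov-i with anyL-sound (setsOf I (𝒫 i)) _ cov-i
  ...   | A , A∈ , U≈A = i , A , A∈ , λ d∈D → eqB⇒≡ (allL-sound D _ U≈A d∈D)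

  sep-exclusive : ∀ {i j A B d} → i ≢ j → A ∈ setsOf I (𝒫 i) → B ∈ setsOf I (𝒫 j) → d ∈ D →
    sepB I A d ≡ true → sepB I B d ≡ false
  sep-exclusive {i} {j} i≢j A∈ B∈ d∈D sepA = Boolₚ.¬-not {y = true} λ sepB′ →
    crossingFree i j i≢j d∈D
      (setsOf-sepM (𝒫 i) (valid i) A∈ d∈D sepA , setsOf-sepM (𝒫 j) (valid j) B∈ d∈D sepB′)

  representative-agrees : ∀ {i A d d′} → A ∈ setsOf I (𝒫 i) → d ∈ D → sepB I A d ≡ true → d′ ∈ D →
    All (λ B → sepB I B d ≡ sepB I B d′) (setsOf I (𝒫 i)) → CutsAgree d d′
  representative-agrees {i} {A} {d} {d′} A∈ d∈D sepA d′∈D agree U cov _ with covered⇒setOf {U} cov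
  ... | j , B , B∈ , U≈B with j Fin.≟ i
  ...   | yes refl = trans (U≈B d∈D) (trans (All.lookup agree B∈) (sym (U≈B d′∈D)))
  ...   | no  j≢i  = trans (U≈B d∈D) (trans (exclusive d∈D sepA)
                                         (sym (trans (U≈B d′∈D) (exclusive d′∈D sepA′))))
    where
    exclusive : ∀ {d} → d ∈ D → sepB I A d ≡ true → sepB I B d ≡ false
    exclusive = sep-exclusive (j≢i ∘ sym) A∈ B∈

    sepA′ : sepB I A d′ ≡ true
    sepA′ = trans (sym (All.lookup agree A∈)) sepA

  Contracted : Fin n → Fin n → Set
  Contracted = Conn λ u v → EdgeLink I (In I pruned) u v ⊎
                            (∃ λ i → ConnectorVertex I (𝒫 i) u × ConnectorVertex I (𝒫 i) v)

  lift : ∀ {u v} → Connected (In I pruned) u v → Contracted u v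
  lift = Conn-mono inj₁

  through-connector : ∀ {U₀ s t} → (s , t) ∈ D → Covered U₀ → Lonely U₀ → sepB I U₀ (s , t) ≡ true →
    Contracted s t
  through-connector {U₀} st∈D cov₀ l₀ sep₀ with covered⇒setOf {U₀} cov₀
  ... | i , A , A∈ , U₀≈A with trans (sym (U₀≈A st∈D)) sep₀
  ... | sepA with representative (𝒫 i) (valid i) st∈D (setsOf-sepM (𝒫 i) (valid i) A∈ st∈D sepA)
  ... | (a , b) , ab∈D , a∈C , b∈C , agree
      with pruned-sides {U₀} cov₀ l₀ sep₀ (OPT-feasible st∈D) (OPT-feasible ab∈D)
                        (representative-agrees A∈ st∈D sepA ab∈D agree)
  ... | inj₁ (s~a , t~b) =
    Conn-trans (lift s~a) (step→ (inj₂ (i , a∈C , b∈C)) (lift (Conn-sym t~b)))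
  ... | inj₂ (s~b , t~a) =
    Conn-trans (lift s~b) (step← (inj₂ (i , a∈C , b∈C)) (lift (Conn-sym t~a)))

  feasible : FeasibleContracted I 𝒫 pruned
  feasible {s} {t} st∈D
    with anySubset? (λ U → covered? U ×-dec lonely? U ×-dec sepB I U (s , t) Bool.≟ true)
  ... | yes (U₀ , cov₀ , l₀ , sep₀) = through-connector {U₀} st∈D cov₀ l₀ sep₀
  ... | no ¬separated = lift (pruned-connected (OPT-feasible st∈D) unseparated)
    where
    unseparated : Unseparated s t
    unseparated U cov l =
      xor≡false⇒≡ (Boolₚ.¬-not {y = true} λ sep → ¬separated (U , cov , l , sep))

  covered-crossed : ∀ {A} → Covered A → countF (crossesOPT A) ≢ 0
  covered-crossed {A} cov with covered⇒setOf {A} cov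
  ... | i , B , B∈ , A≈B with setsOf-sepNonEmpty (𝒫 i) (valid i) B∈
  ... | d , d∈D , sepB-d
    with crossing-edge A (OPT-feasible d∈D) (xor≡true⇒≢ (trans (A≈B d∈D) sepB-d))
  ... | e , o , cr , _ = countF-pos (crossesOPT A) e (crossesOPT-intro {A} o cr)

  covered-lonely : ∀ {A} → Covered A → multiCrossB I OPT A ≡ false → Lonely A
  covered-lonely {A} cov multi with countF (crossesOPT A) in count
  ... | zero        = ⊥-elim (covered-crossed {A} cov count)
  ... | suc zero    = refl
  ... | suc (suc _) with () ← multi

  removedCost : ℚ
  removedCost = ΣF λ e → if removed e then cost e else 0ℚ

  cost-split : costOf I OPT ≡ costOf I pruned + removedCost
  cost-split = trans (ΣF-cong split) (ΣF-+ (λ e → if lookup pruned e then cost e else 0ℚ)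
                                            (λ e → if removed e then cost e else 0ℚ))
    where
    split : ∀ e → (if lookup OPT e then cost e else 0ℚ) ≡
                  (if lookup pruned e then cost e else 0ℚ) + (if removed e then cost e else 0ℚ)
    split e = trans (if-∧-split (cost e) (lookup OPT e) (does (removable? e)))
                    (cong (λ b → (if b then cost e else 0ℚ) + (if removed e then cost e else 0ℚ))
                          (sym (lookup∘tabulate _ e)))

  removedCrossing : Fin m → Subset n → ℚ
  removedCrossing e A = if removed e then 𝟙 (crossB I A e) else 0ℚ

  removedCrossings : Subset n → ℚ
  removedCrossings A = ΣF λ e → removedCrossing e A

  removedCrossing≥0 : ∀ A e → 0ℚ ≤ removedCrossing e A
  removedCrossing≥0 A e with removed e
  ... | true  = 0≤𝟙 _
  ... | false = ℚₚ.≤-refl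

  lonely-removed : ∀ {A} → Covered A → Lonely A → 1ℚ ≤ removedCrossings A
  lonely-removed {A} cov l = begin
    1ℚ                   ≡⟨ cong₂ (λ r c → if r then 𝟙 c else 0ℚ) removed-e cr ⟨
    removedCrossing e A  ≤⟨ ΣF-≥-term (removedCrossing≥0 A) e ⟩
    removedCrossings A   ∎
    where
    open ℚₚ.≤-Reasoning
    e : Fin m
    e = proj₁ (lonely-edge {A} l)

    ce : crossesOPT A e ≡ true
    ce = proj₂ (lonely-edge {A} l)

    cr : crossB I A e ≡ true
    cr = Boolₚ.∧-conicalʳ _ _ ce

    removed-e : removed e ≡ true
    removed-e = cong₂ _∧_ (Boolₚ.∧-conicalˡ _ _ ce) (dec-true (removable? e) (A , cov , l , ce))

  covered≤ : ∀ A → 𝟙 (coveredB I 𝒫 A) ≤ 𝟙 (multiCrossB I OPT A) + removedCrossings A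
  covered≤ A with coveredB I 𝒫 A in cov | multiCrossB I OPT A in multi
  ... | false | b     = 0≤+ (0≤𝟙 b) (ΣF-nonneg (removedCrossing≥0 A))
  ... | true  | true  = begin
    1ℚ                       ≡⟨ ℚₚ.+-identityʳ 1ℚ ⟨
    1ℚ + 0ℚ                  ≤⟨ ℚₚ.+-monoʳ-≤ 1ℚ (ΣF-nonneg (removedCrossing≥0 A)) ⟩
    1ℚ + removedCrossings A  ∎
    where open ℚₚ.≤-Reasoning
  ... | true  | false = begin
    1ℚ                       ≤⟨ lonely-removed {A} cov (covered-lonely {A} cov multi) ⟩
    removedCrossings A       ≡⟨ ℚₚ.+-identityˡ _ ⟨
    0ℚ + removedCrossings A  ∎
    where open ℚₚ.≤-Reasoning

  coverage≤ : (∀ {ph} → ph ∈ H → 0ℚ ≤ proj₁ ph) → (∀ e → load I H e ≤ cost e) →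
    coverage I H 𝒫 ≤ ySum I H (multiCrossB I OPT) + removedCost
  coverage≤ 0≤Δ load≤cost = begin
    coverage I H 𝒫
      ≤⟨ yΣ-mono H 0≤Δ covered≤ ⟩
    yΣ H (λ A → 𝟙 (multiCrossB I OPT A) + removedCrossings A)
      ≡⟨ yΣ-+ H (𝟙 ∘ multiCrossB I OPT) removedCrossings ⟩
    ySum I H (multiCrossB I OPT) + yΣ H removedCrossings
      ≡⟨ cong (ySum I H (multiCrossB I OPT) +_) (ΣF-yΣ H removedCrossing) ⟨
    ySum I H (multiCrossB I OPT) + ΣF (λ e → yΣ H (removedCrossing e))
      ≤⟨ ℚₚ.+-monoʳ-≤ (ySum I H (multiCrossB I OPT)) (ΣF-mono removedLoad≤) ⟩
    ySum I H (multiCrossB I OPT) + removedCost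
      ∎
    where
    open ℚₚ.≤-Reasoning

    removedLoad≤ : ∀ e → yΣ H (removedCrossing e) ≤ (if removed e then cost e else 0ℚ)
    removedLoad≤ e with removed e
    ... | true  = load≤cost e
    ... | false = ℚₚ.≤-reflexive (yΣ-0 H)

  cost-bound : (∀ {ph} → ph ∈ H → 0ℚ ≤ proj₁ ph) → (∀ e → load I H e ≤ cost e) →
    costOf I pruned ≤ (costOf I OPT - coverage I H 𝒫) + ySum I H (multiCrossB I OPT)
  cost-bound 0≤Δ load≤cost = ≤-slack cost-split (coverage≤ 0≤Δ load≤cost)

module Run (I : Instance) (ε : ℚ) where
  open Instance I

  phases≥0 : ∀ {s} → Reachable I ε s → ∀ {ph} → ph ∈ hist s → 0ℚ ≤ proj₁ ph
  phases≥0 (next _ (step _ _ _ _ _ _ _ _ _ 0<Δ _ _ _)) (here refl) = ℚₚ.<⇒≤ 0<Δ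
  phases≥0 (next r (step _ _ _ _ _ _ _ _ _ _   _ _ _)) (there ph∈) = phases≥0 r ph∈

  load≤cost : ∀ {s} → Reachable I ε s → ∀ e → load I (hist s) e ≤ cost e
  load≤cost init                                       = cost≥0
  load≤cost (next _ (step _ _ _ _ _ _ _ _ _ _ load≤ _ _)) = load≤

lemma4p7 : (I : Instance) (ε : ℚ) → 0ℚ ≤ ε →
    (s : State I) → FinalRun I ε s →
    (OPT : Subset (Instance.m I)) → Optimal I OPT → InclMinimal I OPT →
    (k : ℕ) (𝒫 : Fin k → Member I) → (∀ i → ValidMember I (hist s) (𝒫 i)) →
    CrossingFree I 𝒫 →
    ∃ λ F → FeasibleContracted I 𝒫 F ×
      costOf I F ≤ (costOf I OPT - coverage I (hist s) 𝒫) + ySum I (hist s) (multiCrossB I OPT)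
lemma4p7 I ε _ s (reachable , _) OPT (OPT-feasible , _) _ _ 𝒫 valid crossingFree =
  pruned , feasible , cost-bound (phases≥0 reachable) (load≤cost reachable)
  where
  open Run I ε
  open Contraction I (hist s) 𝒫 valid crossingFree OPT OPT-feasible
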